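{- There exists a finite reflexive graph $G$ having a compatible distributive lattice such that for no compatible distributive lattice $L$ does $(G,L)$ admit a tight induced embedding.
   Context: A lattice $L$ on $V(G)$ is compatible with the reflexive graph $G$ if whenever $u\sim u'$ and $v\sim v'$ we have $u\wedge v\sim u'\wedge v'$ and $u\vee v\sim u'\vee v'$. An induced embedding of $(G,L)$ is a lattice embedding $\varphi$ of $L$ into a product of chains $\mathcal{P}=\prod_{i=1}^d\{0,\dots,n_i\}$ (componentwise order) together with reflexive graphs $G_i$ on $\{0,\dots,n_i\}$ compatible with the chain $0<\dots<n_i$ (proper interval graphs), such that $\varphi$ is an isomorphism from $G$ onto the subgraph of the categorical product $\prod G_i$ (where $x\sim y$ iff $x_i\sim y_i$ for all $i$) induced by $\varphi(L)$. It is tight if every cover $x\prec y$ of $L$ is mapped to a cover $\varphi(x)\prec\varphi(y)$ of $\mathcal{P}$. -}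

module Defs where

open import Level using (0ℓ)
open import Data.Nat using (ℕ; suc)
open import Data.Fin using (Fin; _≤_; _<_)
open import Data.Fin.Properties using (_≤?_)
open import Data.Product using (Σ; ∃; _×_; _,_)
open import Relation.Nullary using (¬_; yes; no)
open import Relation.Binary.PropositionalEquality using (_≡_)
open import Function.Definitions using (Injective)
open import Function.Bundles using (_⇔_)
open import Algebra.Core using (Op₂)
import Algebra.Lattice.Structures as LS

record ReflGraph (n : ℕ) : Set₁ where
  field
    _~_   : Fin n → Fin n → Set
    ~-refl : ∀ x → x ~ x
    ~-sym  : ∀ {x y} → x ~ y → y ~ x
open ReflGraph public

record DistLatticeOn (A : Set) : Set where
  field
    _∧_ : Op₂ A
    _∨_ : Op₂ A
    isDistributiveLattice : LS.IsDistributiveLattice (_≡_ {A = A}) _∨_ _∧_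
open DistLatticeOn public

Compatible : {A : Set} → (A → A → Set) → Op₂ A → Op₂ A → Set
Compatible {A} _~_ _∧_ _∨_ =
  ∀ {u u′ v v′ : A} → u ~ u′ → v ~ v′ → ((u ∧ v) ~ (u′ ∧ v′)) × ((u ∨ v) ~ (u′ ∨ v′))

CompatibleLattice : {n : ℕ} → ReflGraph n → DistLatticeOn (Fin n) → Set
CompatibleLattice G L = Compatible (_~_ G) (_∧_ L) (_∨_ L)

_≤[_]_ : {A : Set} → A → DistLatticeOn A → A → Set
x ≤[ L ] y = _∧_ L x y ≡ x

Covers : {A : Set} → DistLatticeOn A → A → A → Set
Covers L x y = (x ≤[ L ] y) × ¬ (x ≡ y) ×
  (∀ z → x ≤[ L ] z → z ≤[ L ] y → (z ≡ x) ⊎' (z ≡ y))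
  where
  open import Data.Sum using () renaming (_⊎_ to _⊎'_)

minF : {k : ℕ} → Fin k → Fin k → Fin k
minF x y with x ≤? y
... | yes _ = x
... | no  _ = y

maxF : {k : ℕ} → Fin k → Fin k → Fin k
maxF x y with x ≤? y
... | yes _ = y
... | no  _ = x

Point : (d : ℕ) → (Fin d → ℕ) → Set
Point d ns = (i : Fin d) → Fin (suc (ns i))

_≤P_ : {d : ℕ} {ns : Fin d → ℕ} → Point d ns → Point d ns → Set
x ≤P y = ∀ i → x i ≤ y i

meetP : {d : ℕ} {ns : Fin d → ℕ} → Point d ns → Point d ns → Point d ns
meetP x y = λ i → minF (x i) (y i)

joinP : {d : ℕ} {ns : Fin d → ℕ} → Point d ns → Point d ns → Point d ns
joinP x y = λ i → maxF (x i) (y i)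

CoversP : {d : ℕ} {ns : Fin d → ℕ} → Point d ns → Point d ns → Set
CoversP {d} {ns} x y = (x ≤P y) × ¬ (x ≡ y) ×
  (∀ (z : Point d ns) → x ≤P z → z ≤P y → (z ≡ x) ⊎' (z ≡ y))
  where
  open import Data.Sum using () renaming (_⊎_ to _⊎'_)

-- Induced embedding of (G, L) into a product of chains with proper interval
-- graphs G_i (reflexive graphs on the chain compatible with the chain lattice).
record InducedEmbedding {n : ℕ} (G : ReflGraph n) (L : DistLatticeOn (Fin n)) : Set₁ where
  field
    d   : ℕ
    ns  : Fin d → ℕ
    Gs  : (i : Fin d) → ReflGraph (suc (ns i))
    Gs-compatible : ∀ i → Compatible (_~_ (Gs i)) minF maxF
    φ   : Fin n → Point d ns
    φ-injective : Injective _≡_ _≡_ φ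
    φ-meet : ∀ x y → φ (_∧_ L x y) ≡ meetP (φ x) (φ y)
    φ-join : ∀ x y → φ (_∨_ L x y) ≡ joinP (φ x) (φ y)
    -- graph isomorphism onto the subgraph of the categorical product induced by φ(L)
    φ-adj : ∀ u v → (_~_ G u v) ⇔ (∀ i → _~_ (Gs i) (φ u i) (φ v i))

Tight : {n : ℕ} {G : ReflGraph n} {L : DistLatticeOn (Fin n)} → InducedEmbedding G L → Set
Tight {n} {G} {L} e = ∀ (x y : Fin n) → Covers L x y → CoversP (φ x) (φ y)
  where open InducedEmbedding e

-- The vertex 0 of G is pendant on 1. In a compatible lattice a pendant vertex is comparable to
-- its neighbour, and then the two form a cover; passing to the dual lattice if necessary, 0 ≤ 1.
-- Compatibility then propagates 0 ≤ v along edges, gives 1 ≤ 5 and 1 ≤ 6, and so forces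
-- 2 ∨ 3 = 4 and 2 ∧ 3 = 1. A tight embedding maps the cover {0, 1} to two points differing in
-- one coordinate, where the image of 1 = 2 ∧ 3 (a componentwise min) agrees with the image of 2
-- or of 3; so 0 would be adjacent to 2 or to 3 in the product of the Gᵢ, hence in G, which it is not.
module Submission where

open import Defs hiding (_∧_; _∨_; _~_; ~-refl; ~-sym)
open import Data.Nat using (ℕ)
open import Data.Fin using (Fin)
open import Data.Product using (Σ; _×_)
open import Relation.Nullary using (¬_)

open import Level using (0ℓ)
open import Data.Nat using (suc; _≤ᵇ_; ∣_-_∣; _⊓_; _⊔_)
open import Data.Nat.Properties using (∣n-n∣≡0; ∣-∣-comm)
open import Data.Fin using (#_; _≟_)
open import Data.Fin.Properties using (all?; ¬∀⟶∃¬; ≤-refl) renaming (_≤?_ to _≤?ᶠ_)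
open import Data.Bool using (T)
open import Data.Bool.Properties using (T?)
open import Data.Unit using (tt)
open import Data.Empty using (⊥-elim)
open import Data.Sum using (_⊎_; inj₁; inj₂; [_,_]′)
import Data.Sum as Sum
open import Data.Product using (_,_; proj₁; proj₂)
import Data.Product as Product
open import Data.Vec using ([]; _∷_; lookup)
open import Function using (id; _∘_; case_of_)
open import Function.Bundles using (Equivalence)
open import Relation.Nullary using (Dec; yes; no)
import Relation.Nullary.Decidable as Dec
open import Relation.Nullary.Decidable using (toWitness; _×-dec_; _⊎-dec_; _→-dec_)
open import Relation.Binary.PropositionalEquality
  using (_≡_; _≢_; refl; sym; trans; cong; cong₂; subst; subst₂; isEquivalence; module ≡-Reasoning)
open import Algebra.Lattice.Bundles using (DistributiveLattice)
import Algebra.Lattice.Properties.DistributiveLattice as DistributiveLatticeProperties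
import Algebra.Lattice.Structures as LS

toDistributiveLattice : {A : Set} → DistLatticeOn A → DistributiveLattice 0ℓ 0ℓ
toDistributiveLattice L = record { isDistributiveLattice = isDistributiveLattice L }

dual : {A : Set} → DistLatticeOn A → DistLatticeOn A
dual L = record
  { _∧_                   = DistLatticeOn._∨_ L
  ; _∨_                   = DistLatticeOn._∧_ L
  ; isDistributiveLattice = ∧-∨-isDistributiveLattice
  }
  where open DistributiveLatticeProperties (toDistributiveLattice L)

module LatticeOrder {A : Set} (L : DistLatticeOn A) where
  open DistLatticeOn L using () renaming (_∧_ to infixr 7 _∧_; _∨_ to infixr 6 _∨_)
  open LS.IsDistributiveLattice (isDistributiveLattice L)
    using (∧-comm; ∨-comm; ∧-assoc; ∨-absorbs-∧; ∧-absorbs-∨)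
  open DistributiveLatticeProperties (toDistributiveLattice L) using (∧-idem)
  open ≡-Reasoning

  infix 4 _≤_
  _≤_ : A → A → Set
  x ≤ y = x ≤[ L ] y

  ≤-antisym : ∀ {x y} → x ≤ y → y ≤ x → x ≡ y
  ≤-antisym {x} {y} x≤y y≤x = trans (sym x≤y) (trans (∧-comm x y) y≤x)

  x∧y≤x : ∀ x y → x ∧ y ≤ x
  x∧y≤x x y = begin
    (x ∧ y) ∧ x  ≡⟨ ∧-comm (x ∧ y) x ⟩
    x ∧ x ∧ y    ≡⟨ ∧-assoc x x y ⟨
    (x ∧ x) ∧ y  ≡⟨ cong (_∧ y) (∧-idem x) ⟩
    x ∧ y        ∎

  x≤x∨y : ∀ x y → x ≤ x ∨ y
  x≤x∨y = ∧-absorbs-∨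

  ≤⇒∨≡ : ∀ {x y} → x ≤ y → x ∨ y ≡ y
  ≤⇒∨≡ {x} {y} x≤y = begin
    x ∨ y        ≡⟨ cong (_∨ y) x≤y ⟨
    (x ∧ y) ∨ y  ≡⟨ ∨-comm (x ∧ y) y ⟩
    y ∨ x ∧ y    ≡⟨ cong (y ∨_) (∧-comm x y) ⟩
    y ∨ y ∧ x    ≡⟨ ∨-absorbs-∧ y x ⟩
    y            ∎

module Duality {A : Set} (L : DistLatticeOn A) where
  open LS.IsDistributiveLattice (isDistributiveLattice L) using (∧-comm; ∨-comm)

  ≥⇒≤ᵈ : ∀ {x y} → y ≤[ L ] x → x ≤[ dual L ] y
  ≥⇒≤ᵈ {x} {y} y≤x = trans (∨-comm x y) (LatticeOrder.≤⇒∨≡ L y≤x)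

  ≤ᵈ⇒≥ : ∀ {x y} → x ≤[ dual L ] y → y ≤[ L ] x
  ≤ᵈ⇒≥ {x} {y} x≤ᵈy = trans (∧-comm y x) (LatticeOrder.≤⇒∨≡ (dual L) x≤ᵈy)

  covers-dual : ∀ {x y} → Covers (dual L) x y → Covers L y x
  covers-dual (x≤ᵈy , x≢y , between) =
    ≤ᵈ⇒≥ x≤ᵈy , x≢y ∘ sym , λ z y≤z z≤x → Sum.swap (between z (≥⇒≤ᵈ z≤x) (≥⇒≤ᵈ y≤z))

compatible-dual : {n : ℕ} {G : ReflGraph n} {L : DistLatticeOn (Fin n)} →
  CompatibleLattice G L → CompatibleLattice G (dual L)
compatible-dual compatible u~u′ v~v′ = Product.swap (compatible u~u′ v~v′)

Pendant : {n : ℕ} → ReflGraph n → Fin n → Fin n → Set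
Pendant G a b = ∀ {w} → ReflGraph._~_ G a w → w ≡ a ⊎ w ≡ b

module PendantVertex
  {n : ℕ} {G : ReflGraph n} {L : DistLatticeOn (Fin n)} (compatible : CompatibleLattice G L)
  {a b : Fin n} (a≢b : a ≢ b) (a~b : ReflGraph._~_ G a b) (pendant : Pendant G a b)
  where
  open ReflGraph G using (~-refl) renaming (_~_ to infix 4 _~_)
  open DistLatticeOn L using () renaming (_∧_ to infixr 7 _∧_)
  open LS.IsDistributiveLattice (isDistributiveLattice L) using (∧-comm)
  open DistributiveLatticeProperties (toDistributiveLattice L) using (∧-idem)
  open LatticeOrder L

  ∧-adjacent : ∀ {u u′ v v′} → u ~ u′ → v ~ v′ → u ∧ v ~ u′ ∧ v′
  ∧-adjacent u~u′ v~v′ = proj₁ (compatible u~u′ v~v′)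

  pendant-comparable : a ≤ b ⊎ b ≤ a
  pendant-comparable =
    Sum.map id (trans (∧-comm b a)) (pendant (subst (_~ a ∧ b) (∧-idem a) (∧-adjacent (~-refl a) a~b)))

  pendant-cover : a ≤ b → Covers L a b
  pendant-cover a≤b = a≤b , a≢b , λ z a≤z z≤b →
    pendant (subst₂ _~_ a≤z (trans (∧-comm b z) z≤b) (∧-adjacent a~b (~-refl z)))

  pendant-≤-closed : a ≤ b → ∀ {v w} → a ≤ v → v ~ w → a ≤ w
  pendant-≤-closed a≤b {v} {w} a≤v v~w
    with pendant (subst (_~ a ∧ w) a≤v (∧-adjacent (~-refl a) v~w))
  ... | inj₁ a≤w   = a≤w
  ... | inj₂ a∧w≡b = ⊥-elim (a≢b (≤-antisym a≤b (subst (_≤ a) a∧w≡b (x∧y≤x a w))))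

  pendant-neighbour-≤ : ∀ {v w} → a ≤ v → b ~ w → v ~ w → ¬ a ~ w → b ≤ v
  pendant-neighbour-≤ {v} {w} a≤v b~w v~w a≁w
    with pendant (subst (_~ b ∧ v) a≤v (∧-adjacent a~b (~-refl v)))
  ... | inj₂ b≤v   = b≤v
  ... | inj₁ b∧v≡a = ⊥-elim (a≁w (subst₂ _~_ b∧v≡a (∧-idem w) (∧-adjacent b~w v~w)))

minF-selective : ∀ {k} (x y : Fin k) → minF x y ≡ x ⊎ minF x y ≡ y
minF-selective x y with x ≤?ᶠ y
... | yes _ = inj₁ refl
... | no  _ = inj₂ refl

maxF-selective : ∀ {k} (x y : Fin k) → maxF x y ≡ x ⊎ maxF x y ≡ y
maxF-selective x y with x ≤?ᶠ y
... | yes _ = inj₂ refl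
... | no  _ = inj₁ refl

module ChainProduct {d : ℕ} {ns : Fin d → ℕ} where

  ApartInAtMostOneCoordinate : Point d ns → Point d ns → Set
  ApartInAtMostOneCoordinate X Y = ∀ {i j} → X i ≢ Y i → j ≢ i → X j ≡ Y j

  apart-sym : ∀ {X Y} → ApartInAtMostOneCoordinate X Y → ApartInAtMostOneCoordinate Y X
  apart-sym apart Yi≢Xi j≢i = sym (apart (Yi≢Xi ∘ sym) j≢i)

  splice : Point d ns → Point d ns → Fin d → Point d ns
  splice X Y k j with j ≟ k
  ... | yes _ = Y j
  ... | no  _ = X j

  splice-at : ∀ X Y k → splice X Y k k ≡ Y k
  splice-at X Y k with k ≟ k
  ... | yes _   = refl
  ... | no  k≢k = ⊥-elim (k≢k refl)

  splice-off : ∀ X Y k j → j ≢ k → splice X Y k j ≡ X j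
  splice-off X Y k j j≢k with j ≟ k
  ... | yes j≡k = ⊥-elim (j≢k j≡k)
  ... | no  _   = refl

  splice-between : ∀ {X Y} k → X ≤P Y → X ≤P splice X Y k × splice X Y k ≤P Y
  splice-between {X} {Y} k X≤Y = lower , upper
    where
    lower : X ≤P splice X Y k
    lower j with j ≟ k
    ... | yes _ = X≤Y j
    ... | no  _ = ≤-refl
    upper : splice X Y k ≤P Y
    upper j with j ≟ k
    ... | yes _ = ≤-refl
    ... | no  _ = X≤Y j

  coversP⇒apart : ∀ {X Y} → CoversP X Y → ApartInAtMostOneCoordinate X Y
  coversP⇒apart {X} {Y} (X≤Y , _ , between) {i} {k} Xi≢Yi k≢i
    with between (splice X Y k) (proj₁ (splice-between k X≤Y)) (proj₂ (splice-between k X≤Y))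
  ... | inj₁ splice≡X = trans (cong (λ Z → Z k) (sym splice≡X)) (splice-at X Y k)
  ... | inj₂ splice≡Y =
    ⊥-elim (Xi≢Yi (trans (sym (splice-off X Y k i (k≢i ∘ sym))) (cong (λ Z → Z i) splice≡Y)))

  module _ (Gs : (i : Fin d) → ReflGraph (suc (ns i))) where

    Adjacent : Point d ns → Point d ns → Set
    Adjacent X Y = ∀ i → ReflGraph._~_ (Gs i) (X i) (Y i)

    adjacent-through : ∀ {X Y W i} → ApartInAtMostOneCoordinate X Y → X i ≢ Y i →
      Adjacent X Y → Adjacent Y W → Y i ≡ W i → Adjacent X W
    adjacent-through {X} {Y} {W} {i} apart Xi≢Yi X~Y Y~W Yi≡Wi j with j ≟ i
    ... | yes refl = subst (ReflGraph._~_ (Gs i) (X i)) Yi≡Wi (X~Y i)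
    ... | no  j≢i  = subst (λ x → ReflGraph._~_ (Gs j) x (W j)) (sym (apart Xi≢Yi j≢i)) (Y~W j)

    adjacent-to-one-of : ∀ {X Y W₁ W₂} → ApartInAtMostOneCoordinate X Y →
      Adjacent X Y → Adjacent Y W₁ → Adjacent Y W₂ → (∀ i → Y i ≡ W₁ i ⊎ Y i ≡ W₂ i) →
      Adjacent X W₁ ⊎ Adjacent X W₂
    adjacent-to-one-of {X} {Y} {W₁} {W₂} apart X~Y Y~W₁ Y~W₂ selects with all? (λ i → X i ≟ Y i)
    ... | yes X≗Y = inj₁ λ j → subst (λ x → ReflGraph._~_ (Gs j) x (W₁ j)) (sym (X≗Y j)) (Y~W₁ j)
    ... | no  X≉Y with ¬∀⟶∃¬ d _ (λ i → X i ≟ Y i) X≉Y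
    ...   | i , Xi≢Yi =
      Sum.map (adjacent-through apart Xi≢Yi X~Y Y~W₁) (adjacent-through apart Xi≢Yi X~Y Y~W₂) (selects i)

module _ {n : ℕ} {G : ReflGraph n} {L : DistLatticeOn (Fin n)} where
  open ReflGraph G using () renaming (_~_ to infix 4 _~_)
  open DistLatticeOn L using () renaming (_∧_ to infixr 7 _∧_; _∨_ to infixr 6 _∨_)

  -- The cover {x, y} is stretched along a single coordinate, where φ y is the min or the max of
  -- φ u and φ w.
  no-tight-embedding : ∀ {x y u w} → Covers L x y ⊎ Covers L y x → y ≡ u ∧ w ⊎ y ≡ u ∨ w →
    x ~ y → y ~ u → y ~ w → ¬ x ~ u → ¬ x ~ w → ¬ Σ (InducedEmbedding G L) Tight
  no-tight-embedding {x} {y} {u} {w} cover split x~y y~u y~w x≁u x≁w (e , tight) =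
    [ x≁u ∘ from (φ-adj x u) , x≁w ∘ from (φ-adj x w) ]′
      (adjacent-to-one-of Gs apart
        (to (φ-adj x y) x~y) (to (φ-adj y u) y~u) (to (φ-adj y w) y~w) (selects split))
    where
    open InducedEmbedding e
    open ChainProduct
    open Equivalence using (to; from)
    apart : ApartInAtMostOneCoordinate (φ x) (φ y)
    apart = [ coversP⇒apart ∘ tight x y , apart-sym ∘ coversP⇒apart ∘ tight y x ]′ cover
    selects : ∀ {z} → z ≡ u ∧ w ⊎ z ≡ u ∨ w → ∀ i → φ z i ≡ φ u i ⊎ φ z i ≡ φ w i
    selects (inj₁ refl) i rewrite φ-meet u w = minF-selective (φ u i) (φ w i)
    selects (inj₂ refl) i rewrite φ-join u w = maxF-selective (φ u i) (φ w i)

Near : ℕ × ℕ → ℕ × ℕ → Set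
Near (a , b) (a′ , b′) = T (∣ a - a′ ∣ ≤ᵇ 1) × T (∣ b - b′ ∣ ≤ᵇ 1)

near-refl : ∀ p → Near p p
near-refl (a , b) rewrite ∣n-n∣≡0 a | ∣n-n∣≡0 b = tt , tt

near-sym : ∀ {p q} → Near p q → Near q p
near-sym {a , b} {a′ , b′} rewrite ∣-∣-comm a a′ | ∣-∣-comm b b′ = id

near? : ∀ p q → Dec (Near p q)
near? (a , b) (a′ , b′) = T? _ ×-dec T? _

-- (G, L₀) is the subgraph of the product of two looped paths on {0,…,3}, and the sublattice of
-- the grid ℕ × ℕ, induced by these eight points; so 0 ⋖ 1 is a cover of L₀ but not of the grid.
point : Fin 8 → ℕ × ℕ
point = lookup ((0 , 0) ∷ (1 , 1) ∷ (2 , 1) ∷ (1 , 2) ∷ (2 , 2) ∷ (3 , 2) ∷ (2 , 3) ∷ (3 , 3) ∷ [])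

-- Inverse of point; the junk value # 0 is never reached from meets and joins of the eight points.
vertexAt : ℕ × ℕ → Fin 8
vertexAt (1 , 1) = # 1
vertexAt (2 , 1) = # 2
vertexAt (1 , 2) = # 3
vertexAt (2 , 2) = # 4
vertexAt (3 , 2) = # 5
vertexAt (2 , 3) = # 6
vertexAt (3 , 3) = # 7
vertexAt _       = # 0

infix 4 _~₀_ _~₀?_
record _~₀_ (x y : Fin 8) : Set where
  constructor adjacent
  field nearby : Near (point x) (point y)

_~₀?_ : ∀ x y → Dec (x ~₀ y)
x ~₀? y = Dec.map′ adjacent _~₀_.nearby (near? (point x) (point y))

edge : ∀ {x y} {{_ : T (∣ proj₁ (point x) - proj₁ (point y) ∣ ≤ᵇ 1)}}
         {{_ : T (∣ proj₂ (point x) - proj₂ (point y) ∣ ≤ᵇ 1)}} → x ~₀ y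
edge {{near₁}} {{near₂}} = adjacent (near₁ , near₂)

0≁2 : ¬ # 0 ~₀ # 2
0≁2 (adjacent (() , _))

0≁3 : ¬ # 0 ~₀ # 3
0≁3 (adjacent (_ , ()))

G : ReflGraph 8
G = record
  { _~_    = _~₀_
  ; ~-refl = λ x → adjacent (near-refl (point x))
  ; ~-sym  = λ { {x} {y} (adjacent x~y) → adjacent (near-sym {point x} {point y} x~y) }
  }

meet₀ join₀ : Fin 8 → Fin 8 → Fin 8
meet₀ x y = vertexAt (Product.zip _⊓_ _⊓_ (point x) (point y))
join₀ x y = vertexAt (Product.zip _⊔_ _⊔_ (point x) (point y))

L₀ : DistLatticeOn (Fin 8)
L₀ = record
  { _∧_ = meet₀
  ; _∨_ = join₀
  ; isDistributiveLattice = record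
    { isLattice = record
      { isEquivalence = isEquivalence
      ; ∨-comm     = toWitness {a? = all? λ x → all? λ y → join₀ x y ≟ join₀ y x} tt
      ; ∨-assoc    = toWitness {a? = all? λ x → all? λ y → all? λ z →
                       join₀ (join₀ x y) z ≟ join₀ x (join₀ y z)} tt
      ; ∨-cong     = cong₂ join₀
      ; ∧-comm     = toWitness {a? = all? λ x → all? λ y → meet₀ x y ≟ meet₀ y x} tt
      ; ∧-assoc    = toWitness {a? = all? λ x → all? λ y → all? λ z →
                       meet₀ (meet₀ x y) z ≟ meet₀ x (meet₀ y z)} tt
      ; ∧-cong     = cong₂ meet₀
      ; absorptive = toWitness {a? = all? λ x → all? λ y → join₀ x (meet₀ x y) ≟ x} tt
                   , toWitness {a? = all? λ x → all? λ y → meet₀ x (join₀ x y) ≟ x} tt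
      }
    ; ∨-distrib-∧ = toWitness {a? = all? λ x → all? λ y → all? λ z →
                      join₀ x (meet₀ y z) ≟ meet₀ (join₀ x y) (join₀ x z)} tt
                  , toWitness {a? = all? λ x → all? λ y → all? λ z →
                      join₀ (meet₀ y z) x ≟ meet₀ (join₀ y x) (join₀ z x)} tt
    ; ∧-distrib-∨ = toWitness {a? = all? λ x → all? λ y → all? λ z →
                      meet₀ x (join₀ y z) ≟ join₀ (meet₀ x y) (meet₀ x z)} tt
                  , toWitness {a? = all? λ x → all? λ y → all? λ z →
                      meet₀ (join₀ y z) x ≟ join₀ (meet₀ y x) (meet₀ z x)} tt
    }
  }

L₀-compatible : CompatibleLattice G L₀
L₀-compatible {u} {u′} {v} {v′} = toWitness
  {a? = all? λ u → all? λ u′ → all? λ v → all? λ v′ →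
    u ~₀? u′ →-dec v ~₀? v′ →-dec (meet₀ u v ~₀? meet₀ u′ v′ ×-dec join₀ u v ~₀? join₀ u′ v′)}
  tt u u′ v v′

pendant₀ : Pendant G (# 0) (# 1)
pendant₀ {w} = toWitness {a? = all? λ w → # 0 ~₀? w →-dec (w ≟ # 0 ⊎-dec w ≟ # 1)} tt w

only-common-neighbour-of-1-5-6 : ∀ x → x ~₀ # 1 → x ~₀ # 5 → x ~₀ # 6 → x ≡ # 4
only-common-neighbour-of-1-5-6 = toWitness
  {a? = all? λ x → x ~₀? # 1 →-dec x ~₀? # 5 →-dec x ~₀? # 6 →-dec x ≟ # 4} tt

common-neighbours-of-2-3 : ∀ x → x ~₀ # 2 → x ~₀ # 3 → x ≡ # 1 ⊎ x ≡ # 2 ⊎ x ≡ # 3 ⊎ x ≡ # 4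
common-neighbours-of-2-3 = toWitness
  {a? = all? λ x → x ~₀? # 2 →-dec x ~₀? # 3 →-dec
    (x ≟ # 1 ⊎-dec x ≟ # 2 ⊎-dec x ≟ # 3 ⊎-dec x ≟ # 4)} tt

module _ {L : DistLatticeOn (Fin 8)} (compatible : CompatibleLattice G L) where
  open DistLatticeOn L using () renaming (_∧_ to infixr 7 _∧_; _∨_ to infixr 6 _∨_)
  open LS.IsDistributiveLattice (isDistributiveLattice L) using (∨-comm; ∨-absorbs-∧)
  open DistributiveLatticeProperties (toDistributiveLattice L) using (∧-idem; ∨-idem)
  open LatticeOrder L
  open PendantVertex {G = G} {L} compatible {# 0} {# 1} (λ ()) edge pendant₀

  ∨-adjacent : ∀ {u u′ v v′} → u ~₀ u′ → v ~₀ v′ → u ∨ v ~₀ u′ ∨ v′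
  ∨-adjacent u~u′ v~v′ = proj₂ (compatible u~u′ v~v′)

  zero-below-one : # 0 ≤ # 1 → Covers L (# 0) (# 1) × # 2 ∧ # 3 ≡ # 1
  zero-below-one 0≤1 = pendant-cover 0≤1 , 2∧3≡1
    where
    0≤2 : # 0 ≤ # 2
    0≤2 = pendant-≤-closed 0≤1 0≤1 edge
    0≤3 : # 0 ≤ # 3
    0≤3 = pendant-≤-closed 0≤1 0≤1 edge
    1≤5 : # 1 ≤ # 5
    1≤5 = pendant-neighbour-≤ {w = # 2} (pendant-≤-closed 0≤1 0≤2 edge) edge edge 0≁2
    1≤6 : # 1 ≤ # 6
    1≤6 = pendant-neighbour-≤ {w = # 3} (pendant-≤-closed 0≤1 0≤3 edge) edge edge 0≁3
    2∨3≡4 : # 2 ∨ # 3 ≡ # 4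
    2∨3≡4 = only-common-neighbour-of-1-5-6 (# 2 ∨ # 3)
      (subst (# 2 ∨ # 3 ~₀_) (∨-idem (# 1)) (∨-adjacent edge edge))
      (subst (# 2 ∨ # 3 ~₀_) (trans (∨-comm (# 5) (# 1)) (≤⇒∨≡ 1≤5)) (∨-adjacent edge edge))
      (subst (# 2 ∨ # 3 ~₀_) (≤⇒∨≡ 1≤6) (∨-adjacent edge edge))
    2∧3≡1 : # 2 ∧ # 3 ≡ # 1
    2∧3≡1 with common-neighbours-of-2-3 (# 2 ∧ # 3)
      (subst (# 2 ∧ # 3 ~₀_) (∧-idem (# 2)) (∧-adjacent edge edge))
      (subst (# 2 ∧ # 3 ~₀_) (∧-idem (# 3)) (∧-adjacent edge edge))
    ... | inj₁ 2∧3≡1               = 2∧3≡1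
    ... | inj₂ (inj₁ 2≤3)          = case trans (sym (≤⇒∨≡ 2≤3)) 2∨3≡4 of λ ()
    ... | inj₂ (inj₂ (inj₁ 2∧3≡3)) = case trans (sym 2∨3≡2) 2∨3≡4 of λ ()
      where
      2∨3≡2 : # 2 ∨ # 3 ≡ # 2
      2∨3≡2 = trans (cong (# 2 ∨_) (sym 2∧3≡3)) (∨-absorbs-∧ (# 2) (# 3))
    ... | inj₂ (inj₂ (inj₂ 2∧3≡4)) = case ≤-antisym 4≤2 2≤4 of λ ()
      where
      4≤2 : # 4 ≤ # 2
      4≤2 = subst (_≤ # 2) 2∧3≡4 (x∧y≤x (# 2) (# 3))
      2≤4 : # 2 ≤ # 4
      2≤4 = subst (# 2 ≤_) 2∨3≡4 (x≤x∨y (# 2) (# 3))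

module _ {L : DistLatticeOn (Fin 8)} (compatible : CompatibleLattice G L) where
  open DistLatticeOn L using () renaming (_∧_ to infixr 7 _∧_; _∨_ to infixr 6 _∨_)
  open Duality L using (≥⇒≤ᵈ; covers-dual)

  zero-one-cover-one-meet-or-join :
    (Covers L (# 0) (# 1) ⊎ Covers L (# 1) (# 0)) × (# 1 ≡ # 2 ∧ # 3 ⊎ # 1 ≡ # 2 ∨ # 3)
  zero-one-cover-one-meet-or-join
    with PendantVertex.pendant-comparable {G = G} {L} compatible {# 0} {# 1} (λ ()) edge pendant₀
  ... | inj₁ 0≤1 = Product.map inj₁ (inj₁ ∘ sym) (zero-below-one {L} compatible 0≤1)
  ... | inj₂ 1≤0 = Product.map (inj₂ ∘ covers-dual) (inj₂ ∘ sym)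
                     (zero-below-one {dual L} (compatible-dual {G = G} {L} compatible) (≥⇒≤ᵈ 1≤0))

proposition6p9 : Σ ℕ λ n → Σ (ReflGraph n) λ G →
    (Σ (DistLatticeOn (Fin n)) λ L₀ → CompatibleLattice G L₀) ×
    ((L : DistLatticeOn (Fin n)) → CompatibleLattice G L →
      ¬ (Σ (InducedEmbedding G L) λ e → Tight e))
proposition6p9 = 8 , G , (L₀ , L₀-compatible) , λ L compatible →
  let cover , split = zero-one-cover-one-meet-or-join {L} compatible
  in  no-tight-embedding cover split edge edge edge 0≁2 0≁3
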